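{- For all natural numbers $k\geq 0$ and $n\geq 0$, every term $t$, and every $i$ with $0\leq i\leq n$, the clause $f(x_{k+1})=i,\ f(m(k,x,\max(s(x_{k+1}),t)))=i\ \vdash$ is derivable by resolution from $C(n)$.
   Context: Work in a first-order language with a constant $0$, unary function symbols $s$ and $f$, a binary function symbol $\max$, a binary predicate symbol $\leq$, and atoms of the form $f(t)=k$ where $t$ is a term and $k$ is a numeral; here $=$ is an uninterpreted binary predicate (no equality axioms). A clause is a sequent $\Pi \vdash \Delta$ of finite multisets of atoms; its variables are implicitly universally quantified. For $n\ge 0$, $C(n)$ consists of, with variables $\alpha,\beta,\gamma$: (C1) $\vdash \alpha \leq \alpha$; (C2) $\max(\alpha,\beta)\leq\gamma \vdash \alpha\leq\gamma$; (C3) $\max(\alpha,\beta)\leq\gamma \vdash \beta\leq\gamma$; (C4$(k)$) $f(\beta)=k,\ f(\alpha)=k,\ s(\beta)\leq\alpha \vdash$ for each $0\le k\le n$; (C5) $\vdash f(\alpha)=0,\ldots, f(\alpha)=n$. A clause is derivable by resolution from $C(n)$ if it is obtained in finitely many steps from variable-renamed copies of clauses of $C(n)$ by the resolution rule (from $\Pi\vdash P,\Delta$ and $\Pi',P'\vdash\Delta'$ and a substitution $\sigma$ with $P\sigma=P'\sigma$, infer $\Pi\sigma,\Pi'\sigma\vdash\Delta\sigma,\Delta'\sigma$) and contraction (merging identical atoms on one side). Let $x_1,x_2,\ldots$ be variables. The term $m(k,x,t)$ is defined by $m(0,x,t)=t$ and $m(k+1,x,t)=m(k,x,\max(s(x_{k+1}),t))$;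 explicitly $m(k,x,t)=\max(s(x_1),\max(s(x_2),\ldots,\max(s(x_k),t)\ldots))$. -}

module Defs where

open import Data.Nat using (ℕ; zero; suc; _≤_)
open import Data.List using (List; []; _∷_; _++_; map; upTo)
open import Data.List.Relation.Binary.Permutation.Propositional using (_↭_)
open import Relation.Binary.PropositionalEquality using (_≡_)
open import Function.Definitions using (Injective)

data Term : Set where
  var  : ℕ → Term
  zer  : Term
  s    : Term → Term
  f    : Term → Term
  max  : Term → Term → Term

num : ℕ → Term
num zero    = zer
num (suc k) = s (num k)

-- Atoms: t ≤ u, and t = u (uninterpreted binary predicate).
data Atom : Set where
  _≤'_ : Term → Term → Atom
  _='_ : Term → Term → Atom

Subst : Set
Subst = ℕ → Term

subT : Subst → Term → Term
subT σ (var x)   = σ x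
subT σ zer       = zer
subT σ (s t)     = s (subT σ t)
subT σ (f t)     = f (subT σ t)
subT σ (max t u) = max (subT σ t) (subT σ u)

subA : Subst → Atom → Atom
subA σ (t ≤' u) = subT σ t ≤' subT σ u
subA σ (t =' u) = subT σ t =' subT σ u

-- A clause Π ⊢ Δ; multisets are lists taken up to permutation (rule `perm`).
record Clause : Set where
  constructor _⊢_
  field
    ante : List Atom
    succ : List Atom
open Clause public

subC : Subst → Clause → Clause
subC σ (Π ⊢ Δ) = map (subA σ) Π ⊢ map (subA σ) Δ

α β γ : Term
α = var 0
β = var 1
γ = var 2

data InC (n : ℕ) : Clause → Set where
  C1 : InC n ([] ⊢ (α ≤' α ∷ []))
  C2 : InC n ((max α β ≤' γ ∷ []) ⊢ (α ≤' γ ∷ []))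
  C3 : InC n ((max α β ≤' γ ∷ []) ⊢ (β ≤' γ ∷ []))
  C4 : (k : ℕ) → k ≤ n →
       InC n ((f β =' num k ∷ f α =' num k ∷ s β ≤' α ∷ []) ⊢ [])
  C5 : InC n ([] ⊢ map (λ j → f α =' num j) (upTo (suc n)))

data Derivable (n : ℕ) : Clause → Set where
  axiom : ∀ {c} → InC n c → (ρ : ℕ → ℕ) → Injective _≡_ _≡_ ρ →
          Derivable n (subC (λ x → var (ρ x)) c)
  perm  : ∀ {Π Π' Δ Δ'} → Derivable n (Π ⊢ Δ) → Π ↭ Π' → Δ ↭ Δ' →
          Derivable n (Π' ⊢ Δ')
  resolve : ∀ {Π Δ Π' Δ' P P'} (σ : Subst) →
          Derivable n (Π ⊢ (P ∷ Δ)) → Derivable n ((P' ∷ Π') ⊢ Δ') →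
          subA σ P ≡ subA σ P' →
          Derivable n ((map (subA σ) Π ++ map (subA σ) Π') ⊢
                       (map (subA σ) Δ ++ map (subA σ) Δ'))
  contrL : ∀ {A Π Δ} → Derivable n ((A ∷ A ∷ Π) ⊢ Δ) → Derivable n ((A ∷ Π) ⊢ Δ)
  contrR : ∀ {A Π Δ} → Derivable n (Π ⊢ (A ∷ A ∷ Δ)) → Derivable n (Π ⊢ (A ∷ Δ))

x : ℕ → Term
x j = var j

m : ℕ → Term → Term
m zero    t = t
m (suc k) t = m k (max (s (x (suc k))) t)

-- Every derivation here is a single resolution of a derived unit clause ⊢ P against a
-- fresh copy of an axiom, whose variables are shifted above those of P so that one
-- substitution can act independently on both.  From ⊢ α ≤ α and C2, C3 one gets
-- ⊢ A ≤ max A B and ⊢ B ≤ max A B; C2 and C3 then peel the nested maxima of m(k,x,-) one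
-- at a time, giving ⊢ s(x_{k+1}) ≤ m(k,x,max(s(x_{k+1}),t)).  Resolving this against
-- C4(i) with α := m(k,x,max(s(x_{k+1}),t)) and β := x_{k+1} leaves the claimed clause.
module Submission where

open import Defs
open import Data.Nat using (ℕ; zero; suc; _≤_; _<_; _<?_; _+_; _∸_; _⊔_)
open import Data.Nat.Properties
  using (≤-trans; <⇒≱; m≤n+m; m+n∸n≡m; +-cancelʳ-≡; m≤m⊔n; m≤n⊔m)
open import Data.List using (List; []; _∷_; map)
open import Data.List.Relation.Binary.Permutation.Propositional
  using (↭-refl; ↭-trans; ↭-prep; ↭-swap)
open import Relation.Nullary using (yes; no)
open import Relation.Binary.PropositionalEquality
  using (_≡_; refl; sym; trans; cong; cong₂; subst; subst₂)
open import Data.Empty using (⊥-elim)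

boundT : Term → ℕ
boundT (var v)   = suc v
boundT zer       = zero
boundT (s t)     = boundT t
boundT (f t)     = boundT t
boundT (max t u) = boundT t ⊔ boundT u

boundA : Atom → ℕ
boundA (t ≤' u) = boundT t ⊔ boundT u
boundA (t =' u) = boundT t ⊔ boundT u

shift : ℕ → Subst
shift N v = var (v + N)

glue : ℕ → Subst → Subst → Subst
glue N ρ τ v with v <? N
... | yes _ = ρ v
... | no  _ = τ (v ∸ N)

glue-below : ∀ N ρ τ {v} → v < N → glue N ρ τ v ≡ ρ v
glue-below N ρ τ {v} v<N with v <? N
... | yes _   = refl
... | no  v≮N = ⊥-elim (v≮N v<N)

glue-shift : ∀ N ρ τ v → glue N ρ τ (v + N) ≡ τ v
glue-shift N ρ τ v with v + N <? N
... | yes v+N<N = ⊥-elim (<⇒≱ v+N<N (m≤n+m N v))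
... | no  _     = cong τ (m+n∸n≡m v N)

subT-glue-below : ∀ {N} ρ τ t → boundT t ≤ N → subT (glue N ρ τ) t ≡ subT ρ t
subT-glue-below ρ τ (var v)   v<N = glue-below _ ρ τ v<N
subT-glue-below ρ τ zer       _   = refl
subT-glue-below ρ τ (s t)     t≤N = cong s (subT-glue-below ρ τ t t≤N)
subT-glue-below ρ τ (f t)     t≤N = cong f (subT-glue-below ρ τ t t≤N)
subT-glue-below ρ τ (max t u) ≤N  =
  cong₂ max (subT-glue-below ρ τ t (≤-trans (m≤m⊔n _ _) ≤N))
            (subT-glue-below ρ τ u (≤-trans (m≤n⊔m _ _) ≤N))

subA-glue-below : ∀ ρ τ P → subA (glue (boundA P) ρ τ) P ≡ subA ρ P
subA-glue-below ρ τ (t ≤' u) =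
  cong₂ _≤'_ (subT-glue-below ρ τ t (m≤m⊔n (boundT t) (boundT u)))
             (subT-glue-below ρ τ u (m≤n⊔m (boundT t) (boundT u)))
subA-glue-below ρ τ (t =' u) =
  cong₂ _='_ (subT-glue-below ρ τ t (m≤m⊔n (boundT t) (boundT u)))
             (subT-glue-below ρ τ u (m≤n⊔m (boundT t) (boundT u)))

subT-glue-shift : ∀ N ρ τ t → subT (glue N ρ τ) (subT (shift N) t) ≡ subT τ t
subT-glue-shift N ρ τ (var v)   = glue-shift N ρ τ v
subT-glue-shift N ρ τ zer       = refl
subT-glue-shift N ρ τ (s t)     = cong s (subT-glue-shift N ρ τ t)
subT-glue-shift N ρ τ (f t)     = cong f (subT-glue-shift N ρ τ t)
subT-glue-shift N ρ τ (max t u) =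
  cong₂ max (subT-glue-shift N ρ τ t) (subT-glue-shift N ρ τ u)

subA-glue-shift : ∀ N ρ τ P → subA (glue N ρ τ) (subA (shift N) P) ≡ subA τ P
subA-glue-shift N ρ τ (t ≤' u) = cong₂ _≤'_ (subT-glue-shift N ρ τ t) (subT-glue-shift N ρ τ u)
subA-glue-shift N ρ τ (t =' u) = cong₂ _='_ (subT-glue-shift N ρ τ t) (subT-glue-shift N ρ τ u)

map-subA-glue-shift : ∀ N ρ τ (Π : List Atom) →
  map (subA (glue N ρ τ)) (map (subA (shift N)) Π) ≡ map (subA τ) Π
map-subA-glue-shift N ρ τ []      = refl
map-subA-glue-shift N ρ τ (P ∷ Π) =
  cong₂ _∷_ (subA-glue-shift N ρ τ P) (map-subA-glue-shift N ρ τ Π)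

subT-var : ∀ t → subT var t ≡ t
subT-var (var v)   = refl
subT-var zer       = refl
subT-var (s t)     = cong s (subT-var t)
subT-var (f t)     = cong f (subT-var t)
subT-var (max t u) = cong₂ max (subT-var t) (subT-var u)

subA-var : ∀ P → subA var P ≡ P
subA-var (t ≤' u) = cong₂ _≤'_ (subT-var t) (subT-var u)
subA-var (t =' u) = cong₂ _='_ (subT-var t) (subT-var u)

subT-num : ∀ τ k → subT τ (num k) ≡ num k
subT-num τ zero    = refl
subT-num τ (suc k) = cong s (subT-num τ k)

⟨_,_,_⟩ : Term → Term → Term → Subst
⟨ a , b , c ⟩ 0 = a
⟨ a , b , c ⟩ 1 = b
⟨ a , b , c ⟩ 2 = c
⟨ a , b , c ⟩ _ = zer

module _ {n : ℕ} where

  Provable : Atom → Set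
  Provable P = Derivable n ([] ⊢ (P ∷ []))

  -- A record rather than a function type, so that the clause is recoverable by unification.
  record FreshCopies (c : Clause) : Set where
    constructor fresh
    field copy : ∀ N → Derivable n (subC (shift N) c)
  open FreshCopies

  axiom-copies : ∀ {c} → InC n c → FreshCopies c
  axiom-copies c∈C = fresh λ N → axiom c∈C (_+ N) (+-cancelʳ-≡ N _ _)

  resolve-unit : ∀ {P Q Π Δ} (ρ τ : Subst) → subA ρ P ≡ subA τ Q →
    Provable P → FreshCopies ((Q ∷ Π) ⊢ Δ) → Derivable n (map (subA τ) Π ⊢ map (subA τ) Δ)
  resolve-unit {P} {Q} {Π} {Δ} ρ τ ρP≡τQ ⊢P copies =
    subst₂ (λ Π′ Δ′ → Derivable n (Π′ ⊢ Δ′))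
      (map-subA-glue-shift N ρ τ Π) (map-subA-glue-shift N ρ τ Δ)
      (resolve (glue N ρ τ) ⊢P (copy copies N) unifies)
    where
    N = boundA P
    unifies : subA (glue N ρ τ) P ≡ subA (glue N ρ τ) (subA (shift N) Q)
    unifies = trans (subA-glue-below ρ τ P) (trans ρP≡τQ (sym (subA-glue-shift N ρ τ Q)))

  ≤-maxˡ : ∀ {P A B G} (ρ : Subst) → subA ρ P ≡ (max A B ≤' G) → Provable P → Provable (A ≤' G)
  ≤-maxˡ {A = A} {B} {G} ρ eq ⊢P = resolve-unit ρ ⟨ A , B , G ⟩ eq ⊢P (axiom-copies C2)

  ≤-maxʳ : ∀ {P A B G} (ρ : Subst) → subA ρ P ≡ (max A B ≤' G) → Provable P → Provable (B ≤' G)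
  ≤-maxʳ {A = A} {B} {G} ρ eq ⊢P = resolve-unit ρ ⟨ A , B , G ⟩ eq ⊢P (axiom-copies C3)

  ≤-refl-axiom : Provable (α ≤' α)
  ≤-refl-axiom = axiom C1 (λ v → v) (λ eq → eq)

  ≤-m-right : ∀ k A B → Provable (B ≤' m k (max A B))
  ≤-m-right zero    A B = ≤-maxʳ (λ _ → max A B) refl ≤-refl-axiom
  ≤-m-right (suc k) A B = ≤-maxʳ {A = A} var (subA-var _) (≤-m-right k (s (x (suc k))) (max A B))

  ≤-m-left : ∀ k A B → Provable (A ≤' m k (max A B))
  ≤-m-left zero    A B = ≤-maxˡ (λ _ → max A B) refl ≤-refl-axiom
  ≤-m-left (suc k) A B = ≤-maxˡ {B = B} var (subA-var _) (≤-m-right k (s (x (suc k))) (max A B))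

  C4-copies : ∀ i → i ≤ n → FreshCopies ((s β ≤' α ∷ f β =' num i ∷ f α =' num i ∷ []) ⊢ [])
  C4-copies i i≤n = fresh λ N →
    perm (copy (axiom-copies (C4 i i≤n)) N)
         (↭-trans (↭-prep _ (↭-swap _ _ ↭-refl)) (↭-swap _ _ ↭-refl)) ↭-refl

corollary2 : (k n : ℕ) (t : Term) (i : ℕ) → i ≤ n →
    Derivable n ((f (x (suc k)) =' num i ∷ f (m k (max (s (x (suc k))) t)) =' num i ∷ []) ⊢ [])
corollary2 k n t i i≤n =
  subst (λ r → Derivable n ((f (x (suc k)) =' r ∷ f M =' r ∷ []) ⊢ [])) (subT-num τ i)
    (resolve-unit var τ (subA-var _) (≤-m-left k X t) (C4-copies i i≤n))
  where
  X = s (x (suc k))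
  M = m k (max X t)
  τ = ⟨ M , x (suc k) , zer ⟩
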